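{- Let $p$ be a prime, let $k$ be a positive integer, and let $n\geq 2$ be an integer coprime with $p$. Put $N=n^{p^k}-1$ and consider the linear Alexander quandle on $\mathbf{Z}/N\mathbf{Z}$ with parameter $n$, i.e. $a\ast b = na+(1-n)b \pmod N$. Fix $b\in\mathbf{Z}/N\mathbf{Z}$ and let $R_b:x\mapsto x\ast b$ be the right translation by $b$. Then, for each $0\leq i\leq k$, the number of proper solutions in $\mathbf{Z}/N\mathbf{Z}$ of $R_b^{\,p^i}(x)= x$ is $n-1$ if $i=0$, and $n^{p^i}-n^{p^{i-1}}$ if $1\leq i\leq k$.
   Context: A quandle is a set $X$ with a binary operation $\ast$ such that for all $a,b,c\in X$: $a\ast a=a$; there is a unique $x\in X$ with $x\ast b=a$; and $(a\ast b)\ast c=(a\ast c)\ast(b\ast c)$. For $m$ invertible modulo $N$, the linear Alexander quandle of order $N$ and parameter $m$ is $\mathbf{Z}/N\mathbf{Z}$ with $a\ast b=ma+(1-m)b \pmod N$. The right translation $R_b$ is the permutation $x\mapsto x\ast b$, and $R_b^{\,l}$ denotes its $l$-fold iterate. An element $x$ is a proper solution of $R_b^{\,p^i}(x)=x$ if it satisfies $R_b^{\,p^i}(x)=x$ but does not satisfy $R_b^{\,p^j}(x)=x$ for any $0\le j<i$ (for $i=0$, proper solutions are simply the solutions of $R_b(x)=x$). -}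

module Defs where

open import Data.Nat as ℕ using (ℕ; zero; suc; _^_; _∸_; _<_; NonZero)
open import Data.Integer as ℤ using (ℤ; +_)
open import Data.Integer.DivMod using (_%ℕ_)
open import Data.List using (List; upTo; filter; length)
open import Data.Product using (_×_)
open import Relation.Binary.PropositionalEquality using (_≡_)
open import Relation.Nullary using (¬_; Dec)
open import Relation.Unary using (Decidable)
open import Data.List.Relation.Unary.All using (All; all?)
open import Data.Nat.Properties using (_≟_)
open import Relation.Nullary.Decidable using (_×-dec_; ¬?)

-- Z/NZ is represented by the canonical residues 0,1,…,N-1 (naturals < N).

alexOp : (N : ℕ) .{{_ : NonZero N}} → ℤ → ℕ → ℕ → ℕ
alexOp N m a b = (m ℤ.* (+ a) ℤ.+ (ℤ.1ℤ ℤ.- m) ℤ.* (+ b)) %ℕ N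

rightTrans : (N : ℕ) .{{_ : NonZero N}} → ℤ → ℕ → ℕ → ℕ
rightTrans N m b x = alexOp N m x b

iter : {A : Set} → (A → A) → ℕ → A → A
iter f zero x = x
iter f (suc l) x = f (iter f l x)

solves : (N : ℕ) .{{_ : NonZero N}} → ℤ → ℕ → ℕ → ℕ → Set
solves N m b l x = iter (rightTrans N m b) l x ≡ x

solves? : (N : ℕ) .{{_ : NonZero N}} → (m : ℤ) (b l : ℕ) → Decidable (solves N m b l)
solves? N m b l x = iter (rightTrans N m b) l x ≟ x

properSolution : (N : ℕ) .{{_ : NonZero N}} → ℤ → (p b i x : ℕ) → Set
properSolution N m p b i x =
  solves N m b (p ^ i) x × All (λ j → ¬ solves N m b (p ^ j) x) (upTo i)

properSolution? : (N : ℕ) .{{_ : NonZero N}} → (m : ℤ) (p b i : ℕ) →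
                  Decidable (properSolution N m p b i)
properSolution? N m p b i x =
  solves? N m b (p ^ i) x ×-dec all? (λ j → ¬? (solves? N m b (p ^ j) x)) (upTo i)

numProperSolutions : (N : ℕ) .{{_ : NonZero N}} → ℤ → (p b i : ℕ) → ℕ
numProperSolutions N m p b i = length (filter (properSolution? N m p b i) (upTo N))

-- R_b is multiplication by n centred at b, so R_b^l(x) − b ≡ n^l (x − b) (mod N), and
-- for x a residue R_b^l(x) = x iff N ∣ (n^l − 1)(x − b).  When l = p^j with j ≤ k,
-- D = n^{p^j} − 1 divides N = n^{p^k} − 1, so the solutions are the residues
-- x ≡ b (mod N/D): there are exactly D of them.  The solution sets grow with j, so
-- the proper solutions at level i ≥ 1 number (n^{p^i} − 1) − (n^{p^{i−1}} − 1).
module Submission where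

open import Defs
open import Data.Nat using (ℕ; zero; suc; _^_; _∸_; _<_; _≤_; _≥_; NonZero)
open import Data.Nat.Primality using (Prime)
open import Data.Nat.Coprimality using (Coprime)
open import Data.Integer using (+_)
open import Data.Product using (_×_)
open import Relation.Binary.PropositionalEquality using (_≡_)

open import Level using (Level; 0ℓ)
open import Data.Nat as ℕ using (z≤n; _%_; _≟_)
import Data.Nat.Properties as ℕ
import Data.Nat.Divisibility as ℕ
open import Data.Nat.DivMod using (m<n⇒m%n≡m; m%n<n; [m+n]%n≡m%n)
open import Data.Integer as ℤ using (ℤ; 0ℤ; 1ℤ; _+_; _-_; -_; _*_)
import Data.Integer.Properties as ℤ
open import Data.Integer.DivMod using (_%ℕ_; _/ℕ_; a≡a%ℕn+[a/ℕn]*n; n%ℕd<d)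
open import Data.Integer.Divisibility.Signed
  using ( _∣_; divides; ∣-refl; ∣⇒∣ᵤ; ∣m⇒∣-m; ∣m∣n⇒∣m+n; ∣m∣n⇒∣m-n; ∣n⇒∣m*n
        ; *-cancelʳ-∣; *-monoˡ-∣)
open import Data.Integer.Tactic.RingSolver using (solve-∀)
open import Data.List using (List; []; _∷_; [_]; _++_; _∷ʳ_; map; filter; length; upTo)
open import Data.List.Properties
  using ( filter-++; filter-none; filter-accept; filter-reject; filter-≐
        ; length-++; length-map; map-++; upTo-∷ʳ; ++-assoc; ++-identityʳ)
open import Data.List.Relation.Unary.All as All using (All; []; _∷_)
open import Data.List.Relation.Unary.All.Properties using (all-upTo)
open import Data.List.Membership.Propositional.Properties using (∈-upTo⁺; ∈-upTo⁻)
open import Data.Product using (_,_; proj₁)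
open import Function using (_∘_)
open import Function.Bundles using (_⇔_; mk⇔; module Equivalence)
open import Function.Properties.Equivalence using (⇔-setoid)
open import Relation.Binary.Bundles using (Setoid)
import Relation.Binary.Reasoning.Setoid as SetoidReasoning
open import Relation.Binary.PropositionalEquality
  using (refl; sym; trans; cong; cong₂; subst; subst₂; module ≡-Reasoning)
open import Relation.Nullary using (¬_; yes; no; contradiction)
open import Relation.Nullary.Decidable using (_×-dec_; ¬?)
open import Relation.Unary using (Pred; Decidable; _⊆_; _≐_)

private variable
  a ℓ ℓ′ : Level
  A B : Set a

-- A record rather than an abbreviation for + N ∣ a - b, so that a and b can be inferred.
infix 4 _≡_mod_
record _≡_mod_ (a b : ℤ) (N : ℕ) : Set where
  constructor mod-by
  field divides-difference : + N ∣ a - b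

module _ {N : ℕ} where

  mod-refl : ∀ {a} → a ≡ a mod N
  mod-refl {a} = mod-by (divides 0ℤ (ℤ.+-inverseʳ a))

  ≡⇒≡-mod : ∀ {a b} → a ≡ b → a ≡ b mod N
  ≡⇒≡-mod refl = mod-refl

  mod-sym : ∀ {a b} → a ≡ b mod N → b ≡ a mod N
  mod-sym {a} {b} (mod-by N∣a-b) = mod-by (subst (+ N ∣_) (lemma a b) (∣m⇒∣-m N∣a-b))
    where lemma : ∀ a b → - (a - b) ≡ b - a
          lemma = solve-∀

  mod-trans : ∀ {a b c} → a ≡ b mod N → b ≡ c mod N → a ≡ c mod N
  mod-trans {a} {b} {c} (mod-by N∣a-b) (mod-by N∣b-c) =
    mod-by (subst (+ N ∣_) (lemma a b c) (∣m∣n⇒∣m+n N∣a-b N∣b-c))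
    where lemma : ∀ a b c → (a - b) + (b - c) ≡ a - c
          lemma = solve-∀

  ∣-resp-mod : ∀ {a b} → a ≡ b mod N → + N ∣ a → + N ∣ b
  ∣-resp-mod {a} {b} (mod-by N∣a-b) N∣a = subst (+ N ∣_) (lemma a b) (∣m∣n⇒∣m-n N∣a N∣a-b)
    where lemma : ∀ a b → a - (a - b) ≡ b
          lemma = solve-∀

  +-congʳ-mod : ∀ {a b} c → a ≡ b mod N → a + c ≡ b + c mod N
  +-congʳ-mod {a} {b} c (mod-by N∣a-b) = mod-by (subst (+ N ∣_) (lemma a b c) N∣a-b)
    where lemma : ∀ a b c → a - b ≡ (a + c) - (b + c)
          lemma = solve-∀

  *-congˡ-mod : ∀ {a b} c → a ≡ b mod N → c * a ≡ c * b mod N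
  *-congˡ-mod {a} {b} c (mod-by N∣a-b) = mod-by (subst (+ N ∣_) (lemma a b c) (∣n⇒∣m*n c N∣a-b))
    where lemma : ∀ a b c → c * (a - b) ≡ c * a - c * b
          lemma = solve-∀

mod-setoid : ℕ → Setoid 0ℓ 0ℓ
mod-setoid N = record
  { _≈_           = λ a b → a ≡ b mod N
  ; isEquivalence = record { refl = mod-refl ; sym = mod-sym ; trans = mod-trans }
  }

module ≡-mod-Reasoning (N : ℕ) = SetoidReasoning (mod-setoid N)

module _ {N : ℕ} .{{_ : NonZero N}} where

  %ℕ-mod : ∀ a → + (a %ℕ N) ≡ a mod N
  %ℕ-mod a = mod-by (divides (- (a /ℕ N)) (begin
    + (a %ℕ N) - a                            ≡⟨ cong (λ t → + (a %ℕ N) - t) (a≡a%ℕn+[a/ℕn]*n a N) ⟩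
    + (a %ℕ N) - (+ (a %ℕ N) + a /ℕ N * + N)  ≡⟨ lemma (+ (a %ℕ N)) (a /ℕ N) (+ N) ⟩
    - (a /ℕ N) * + N                          ∎))
    where
    open ≡-Reasoning
    lemma : ∀ r q n → r - (r + q * n) ≡ - q * n
    lemma = solve-∀

  ≡-mod⇒≡ : ∀ {r s} → r < N → s < N → + r ≡ + s mod N → r ≡ s
  ≡-mod⇒≡ {r} {s} r<N s<N (mod-by N∣r-s) =
    ℤ.+-injective (ℤ.i-j≡0⇒i≡j _ _ (ℤ.∣i∣≡0⇒i≡0 ∣r-s∣≡0))
    where
    ∣r-s∣<N : ℤ.∣ + r - + s ∣ < N
    ∣r-s∣<N = subst (_< N) (sym (cong ℤ.∣_∣ (ℤ.[+m]-[+n]≡m⊖n r s)))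
                (ℕ.≤-<-trans (ℤ.∣m⊝n∣≤m⊔n r s) (ℕ.⊔-lub r<N s<N))
    ∣r-s∣≡0 : ℤ.∣ + r - + s ∣ ≡ 0
    ∣r-s∣≡0 = trans (sym (m<n⇒m%n≡m ∣r-s∣<N)) (ℕ.n∣m⇒m%n≡0 _ N (∣⇒∣ᵤ N∣r-s))

  %≡%⇔≡-mod : ∀ x y → (x % N ≡ y % N) ⇔ (+ x ≡ + y mod N)
  %≡%⇔≡-mod x y = mk⇔ to from
    where
    open ≡-mod-Reasoning N
    to : x % N ≡ y % N → + x ≡ + y mod N
    to x%N≡y%N = begin
      + x        ≈⟨ mod-sym (%ℕ-mod (+ x)) ⟩
      + (x % N)  ≡⟨ cong +_ x%N≡y%N ⟩
      + (y % N)  ≈⟨ %ℕ-mod (+ y) ⟩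
      + y        ∎
    from : + x ≡ + y mod N → x % N ≡ y % N
    from x≡y = ≡-mod⇒≡ (m%n<n x N) (m%n<n y N) (begin
      + (x % N)  ≈⟨ %ℕ-mod (+ x) ⟩
      + x        ≈⟨ x≡y ⟩
      + y        ≈⟨ mod-sym (%ℕ-mod (+ y)) ⟩
      + (y % N)  ∎)

[i-1]∣[i^n-1] : ∀ i n → i - 1ℤ ∣ i ℤ.^ n - 1ℤ
[i-1]∣[i^n-1] i zero    = divides 0ℤ refl
[i-1]∣[i^n-1] i (suc n) =
  subst (i - 1ℤ ∣_) (lemma i (i ℤ.^ n)) (∣m∣n⇒∣m+n (∣n⇒∣m*n i ([i-1]∣[i^n-1] i n)) ∣-refl)
  where lemma : ∀ i j → i * (j - 1ℤ) + (i - 1ℤ) ≡ i * j - 1ℤ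
        lemma = solve-∀

*-cancel-∣ : ∀ k i j .{{_ : ℤ.NonZero k}} → (i * k ∣ k * j) ⇔ (i ∣ j)
*-cancel-∣ k i j = mk⇔ (*-cancelʳ-∣ k ∘ subst (i * k ∣_) (ℤ.*-comm k j))
                       (subst (i * k ∣_) (ℤ.*-comm j k) ∘ *-monoˡ-∣ k)

pos-^ : ∀ n l → + (n ^ l) ≡ (+ n) ℤ.^ l
pos-^ n zero    = refl
pos-^ n (suc l) = trans (ℤ.pos-* n (n ^ l)) (cong (+ n *_) (pos-^ n l))

pos-^∸1 : ∀ n l .{{_ : NonZero n}} → + (n ^ l ∸ 1) ≡ (+ n) ℤ.^ l - 1ℤ
pos-^∸1 n l = begin
  + (n ^ l ∸ 1)         ≡⟨ ℤ.⊖-≥ (ℕ.m^n>0 n l) ⟨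
  n ^ l ℤ.⊖ 1           ≡⟨ ℤ.m-n≡m⊖n (n ^ l) 1 ⟨
  + (n ^ l) - 1ℤ        ≡⟨ cong (_- 1ℤ) (pos-^ n l) ⟩
  (+ n) ℤ.^ l - 1ℤ      ∎
  where open ≡-Reasoning

n^l∸1∣n^l′∸1 : ∀ n {l l′} .{{_ : NonZero n}} → l ℕ.∣ l′ → n ^ l ∸ 1 ℕ.∣ n ^ l′ ∸ 1
n^l∸1∣n^l′∸1 n {l} (ℕ.divides-refl t) =
  ∣⇒∣ᵤ (subst₂ _∣_ (sym (pos-^∸1 n l)) (sym (pos-^∸1 n (t ℕ.* l)))
    (subst (λ e → (+ n) ℤ.^ l - 1ℤ ∣ e - 1ℤ) n^l^t≡n^[t*l] ([i-1]∣[i^n-1] ((+ n) ℤ.^ l) t)))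
  where
  n^l^t≡n^[t*l] : ((+ n) ℤ.^ l) ℤ.^ t ≡ (+ n) ℤ.^ (t ℕ.* l)
  n^l^t≡n^[t*l] = trans (ℤ.^-*-assoc (+ n) l t) (cong ((+ n) ℤ.^_) (ℕ.*-comm l t))

m^i∣m^j : ∀ m {i j} → i ≤ j → m ^ i ℕ.∣ m ^ j
m^i∣m^j m {i} {j} i≤j = ℕ.divides (m ^ (j ∸ i)) (begin
  m ^ j                   ≡⟨ cong (m ^_) (ℕ.m+[n∸m]≡n i≤j) ⟨
  m ^ (i ℕ.+ (j ∸ i))     ≡⟨ ℕ.^-distribˡ-+-* m i (j ∸ i) ⟩
  m ^ i ℕ.* m ^ (j ∸ i)   ≡⟨ ℕ.*-comm (m ^ i) _ ⟩
  m ^ (j ∸ i) ℕ.* m ^ i   ∎)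
  where open ≡-Reasoning

∣-nonZero : ∀ {d n} .{{_ : NonZero n}} → d ℕ.∣ n → NonZero d
∣-nonZero {n = n} d∣n = ℕ.≢-nonZero λ { refl → ℕ.≢-nonZero⁻¹ n (ℕ.0∣⇒≡0 d∣n) }

[m∸1]∸[n∸1]≡m∸n : ∀ m {n} → 1 ≤ n → (m ∸ 1) ∸ (n ∸ 1) ≡ m ∸ n
[m∸1]∸[n∸1]≡m∸n m 1≤n = trans (ℕ.∸-+-assoc m 1 _) (cong (m ∸_) (ℕ.m+[n∸m]≡n 1≤n))

filter-cong-All : {P : Pred A ℓ} {Q : Pred A ℓ′} (P? : Decidable P) (Q? : Decidable Q) {xs : List A} →
                  All (λ x → P x ⇔ Q x) xs → filter P? xs ≡ filter Q? xs
filter-cong-All P? Q? [] = refl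
filter-cong-All P? Q? {x ∷ _} (P⇔Q ∷ rest) with P? x | Q? x
... | yes _  | yes _  = cong (x ∷_) (filter-cong-All P? Q? rest)
... | no _   | no _   = filter-cong-All P? Q? rest
... | yes px | no ¬qx = contradiction (Equivalence.to P⇔Q px) ¬qx
... | no ¬px | yes qx = contradiction (Equivalence.from P⇔Q qx) ¬px

filter-map : {P : Pred B ℓ} (P? : Decidable P) (f : A → B) (xs : List A) →
             filter P? (map f xs) ≡ map f (filter (P? ∘ f) xs)
filter-map P? f []       = refl
filter-map P? f (x ∷ xs) with P? (f x)
... | yes _ = cong (f x ∷_) (filter-map P? f xs)
... | no _  = filter-map P? f xs

length-filter-++ : {P : Pred A ℓ} (P? : Decidable P) (xs ys : List A) →
                   length (filter P? (xs ++ ys)) ≡ length (filter P? xs) ℕ.+ length (filter P? ys)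
length-filter-++ P? xs ys = trans (cong length (filter-++ P? xs ys)) (length-++ (filter P? xs))

length-filter-∖ : {P : Pred A ℓ} {Q : Pred A ℓ′} (P? : Decidable P) (Q? : Decidable Q) → Q ⊆ P →
                  (xs : List A) →
                  length (filter (λ x → P? x ×-dec ¬? (Q? x)) xs) ℕ.+ length (filter Q? xs)
                    ≡ length (filter P? xs)
length-filter-∖ P? Q? Q⊆P []       = refl
length-filter-∖ P? Q? Q⊆P (x ∷ xs) with P? x | Q? x
... | yes _  | yes _  = trans (ℕ.+-suc _ _) (cong suc (length-filter-∖ P? Q? Q⊆P xs))
... | yes _  | no _   = cong suc (length-filter-∖ P? Q? Q⊆P xs)
... | no _   | no _   = length-filter-∖ P? Q? Q⊆P xs
... | no ¬px | yes qx = contradiction (Q⊆P qx) ¬px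

upTo-+ : ∀ m n → upTo (m ℕ.+ n) ≡ upTo m ++ map (m ℕ.+_) (upTo n)
upTo-+ m zero    = trans (cong upTo (ℕ.+-identityʳ m)) (sym (++-identityʳ (upTo m)))
upTo-+ m (suc n) = begin
  upTo (m ℕ.+ suc n)                                      ≡⟨ cong upTo (ℕ.+-suc m n) ⟩
  upTo (suc (m ℕ.+ n))                                    ≡⟨ upTo-∷ʳ (m ℕ.+ n) ⟨
  upTo (m ℕ.+ n) ∷ʳ (m ℕ.+ n)                             ≡⟨ cong (_∷ʳ (m ℕ.+ n)) (upTo-+ m n) ⟩
  (upTo m ++ map (m ℕ.+_) (upTo n)) ∷ʳ (m ℕ.+ n)          ≡⟨ ++-assoc (upTo m) _ _ ⟩
  upTo m ++ (map (m ℕ.+_) (upTo n) ++ map (m ℕ.+_) [ n ]) ≡⟨ cong (upTo m ++_) (map-++ (m ℕ.+_) (upTo n) [ n ]) ⟨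
  upTo m ++ map (m ℕ.+_) (upTo n ∷ʳ n)                    ≡⟨ cong (λ l → upTo m ++ map (m ℕ.+_) l) (upTo-∷ʳ n) ⟩
  upTo m ++ map (m ℕ.+_) (upTo (suc n))                   ∎
  where open ≡-Reasoning

length-filter-≟-upTo : ∀ {r} M → r < M → length (filter (_≟ r) (upTo M)) ≡ 1
length-filter-≟-upTo {r} (suc M) r<1+M = begin
  length (filter (_≟ r) (upTo (suc M)))                             ≡⟨ cong (length ∘ filter (_≟ r)) (upTo-∷ʳ M) ⟨
  length (filter (_≟ r) (upTo M ++ [ M ]))                          ≡⟨ length-filter-++ (_≟ r) (upTo M) [ M ] ⟩
  length (filter (_≟ r) (upTo M)) ℕ.+ length (filter (_≟ r) [ M ])  ≡⟨ lastOrEarlier ⟩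
  1                                                                 ∎
  where
  open ≡-Reasoning
  lastOrEarlier : length (filter (_≟ r) (upTo M)) ℕ.+ length (filter (_≟ r) [ M ]) ≡ 1
  lastOrEarlier with M ≟ r
  ... | yes refl = cong₂ ℕ._+_ (cong length (filter-none (_≟ M) (All.map ℕ.<⇒≢ (all-upTo M))))
                               (cong length (filter-accept (_≟ M) refl))
  ... | no M≢r   = cong₂ ℕ._+_ (length-filter-≟-upTo M (ℕ.≤∧≢⇒< (ℕ.≤-pred r<1+M) (M≢r ∘ sym)))
                               (cong length (filter-reject (_≟ r) M≢r))

length-filter-%≟-upTo : ∀ M .{{_ : NonZero M}} {r} → r < M → ∀ D →
                        length (filter (λ x → x % M ≟ r) (upTo (D ℕ.* M))) ≡ D
length-filter-%≟-upTo M r<M zero    = refl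
length-filter-%≟-upTo M {r} r<M (suc D) = begin
  length (filter R? (upTo (M ℕ.+ D ℕ.* M)))                       ≡⟨ cong (length ∘ filter R?) (upTo-+ M (D ℕ.* M)) ⟩
  length (filter R? (upTo M ++ map (M ℕ.+_) xs))                  ≡⟨ length-filter-++ R? (upTo M) _ ⟩
  length (filter R? (upTo M)) ℕ.+ length (filter R? (map (M ℕ.+_) xs)) ≡⟨ cong₂ ℕ._+_ firstBlock laterBlocks ⟩
  1 ℕ.+ D                                                         ∎
  where
  open ≡-Reasoning
  R? : Decidable (λ x → x % M ≡ r)
  R? x = x % M ≟ r
  xs : List ℕ
  xs = upTo (D ℕ.* M)
  firstBlock : length (filter R? (upTo M)) ≡ 1
  firstBlock = trans (cong length (filter-cong-All R? (_≟ r) (All.map x%M≡r⇔x≡r (all-upTo M))))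
                     (length-filter-≟-upTo M r<M)
    where
    x%M≡r⇔x≡r : ∀ {x} → x < M → (x % M ≡ r) ⇔ (x ≡ r)
    x%M≡r⇔x≡r x<M = mk⇔ (trans (sym (m<n⇒m%n≡m x<M))) (trans (m<n⇒m%n≡m x<M))
  laterBlocks : length (filter R? (map (M ℕ.+_) xs)) ≡ D
  laterBlocks = begin
    length (filter R? (map (M ℕ.+_) xs))              ≡⟨ cong length (filter-map R? (M ℕ.+_) xs) ⟩
    length (map (M ℕ.+_) (filter (R? ∘ (M ℕ.+_)) xs)) ≡⟨ length-map (M ℕ.+_) (filter (R? ∘ (M ℕ.+_)) xs) ⟩
    length (filter (R? ∘ (M ℕ.+_)) xs)                ≡⟨ cong length (filter-≐ (R? ∘ (M ℕ.+_)) R? shift xs) ⟩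
    length (filter R? xs)                             ≡⟨ length-filter-%≟-upTo M r<M D ⟩
    D                                                 ∎
    where
    M+x%M : ∀ x → (M ℕ.+ x) % M ≡ x % M
    M+x%M x = trans (cong (_% M) (ℕ.+-comm M x)) ([m+n]%n≡m%n x M)
    shift : (λ x → (M ℕ.+ x) % M ≡ r) ≐ (λ x → x % M ≡ r)
    shift = trans (sym (M+x%M _)) , trans (M+x%M _)

iter-+ : (f : A → A) (l l′ : ℕ) (x : A) → iter f (l ℕ.+ l′) x ≡ iter f l (iter f l′ x)
iter-+ f zero    l′ x = refl
iter-+ f (suc l) l′ x = cong f (iter-+ f l l′ x)

iter-*-fixed : (f : A → A) {l : ℕ} {x : A} → iter f l x ≡ x → ∀ t → iter f (t ℕ.* l) x ≡ x
iter-*-fixed f         fixed zero    = refl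
iter-*-fixed f {l} {x} fixed (suc t) = begin
  iter f (l ℕ.+ t ℕ.* l) x       ≡⟨ iter-+ f l (t ℕ.* l) x ⟩
  iter f l (iter f (t ℕ.* l) x)  ≡⟨ cong (iter f l) (iter-*-fixed f fixed t) ⟩
  iter f l x                     ≡⟨ fixed ⟩
  x                              ∎
  where open ≡-Reasoning

iter-fixed-∣ : (f : A → A) {l l′ : ℕ} {x : A} → iter f l x ≡ x → l ℕ.∣ l′ → iter f l′ x ≡ x
iter-fixed-∣ f fixed (ℕ.divides-refl t) = iter-*-fixed f fixed t

module _ (N : ℕ) .{{_ : NonZero N}} (m : ℤ) (b : ℕ) where

  rightTrans-mod : ∀ y → + rightTrans N m b y - + b ≡ m * (+ y - + b) mod N
  rightTrans-mod y = begin
    + rightTrans N m b y - + b       ≈⟨ +-congʳ-mod (- + b) (%ℕ-mod (m * + y + (1ℤ - m) * + b)) ⟩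
    m * + y + (1ℤ - m) * + b - + b   ≡⟨ lemma m (+ y) (+ b) ⟩
    m * (+ y - + b)                  ∎
    where
    open ≡-mod-Reasoning N
    lemma : ∀ m y b → m * y + (1ℤ - m) * b - b ≡ m * (y - b)
    lemma = solve-∀

  iter-rightTrans-mod : ∀ l x → + iter (rightTrans N m b) l x - + b ≡ m ℤ.^ l * (+ x - + b) mod N
  iter-rightTrans-mod zero    x = ≡⇒≡-mod (sym (ℤ.*-identityˡ (+ x - + b)))
  iter-rightTrans-mod (suc l) x = begin
    + rightTrans N m b (iter (rightTrans N m b) l x) - + b  ≈⟨ rightTrans-mod _ ⟩
    m * (+ iter (rightTrans N m b) l x - + b)               ≈⟨ *-congˡ-mod m (iter-rightTrans-mod l x) ⟩
    m * (m ℤ.^ l * (+ x - + b))                             ≡⟨ ℤ.*-assoc m (m ℤ.^ l) _ ⟨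
    m ℤ.^ suc l * (+ x - + b)                               ∎
    where open ≡-mod-Reasoning N

  iter-rightTrans-< : ∀ l {x} → x < N → iter (rightTrans N m b) l x < N
  iter-rightTrans-< zero        x<N = x<N
  iter-rightTrans-< (suc l) {x} _   = n%ℕd<d (m * + iter (rightTrans N m b) l x + (1ℤ - m) * + b) N

  solves⇔∣ : ∀ l {x} → x < N → solves N m b l x ⇔ (+ N ∣ (m ℤ.^ l - 1ℤ) * (+ x - + b))
  solves⇔∣ l {x} x<N = mk⇔
    (λ fixed → ∣-resp-mod displacement (_≡_mod_.divides-difference (≡⇒≡-mod {N = N} (cong +_ fixed))))
    (λ N∣ → ≡-mod⇒≡ (iter-rightTrans-< l x<N) x<N (mod-by (∣-resp-mod (mod-sym displacement) N∣)))
    where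
    y : ℕ
    y = iter (rightTrans N m b) l x
    displacement : + y - + x ≡ (m ℤ.^ l - 1ℤ) * (+ x - + b) mod N
    displacement = begin
      + y - + x                              ≡⟨ lemma₁ (+ y) (+ x) (+ b) ⟩
      (+ y - + b) - (+ x - + b)              ≈⟨ +-congʳ-mod (- (+ x - + b)) (iter-rightTrans-mod l x) ⟩
      m ℤ.^ l * (+ x - + b) - (+ x - + b)    ≡⟨ lemma₂ (m ℤ.^ l) (+ x - + b) ⟩
      (m ℤ.^ l - 1ℤ) * (+ x - + b)           ∎
      where
      open ≡-mod-Reasoning N
      lemma₁ : ∀ y x b → y - x ≡ (y - b) - (x - b)
      lemma₁ = solve-∀
      lemma₂ : ∀ a c → a * c - c ≡ (a - 1ℤ) * c
      lemma₂ = solve-∀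

  solves-p^ : ∀ p {i j x} → i ≤ j → solves N m b (p ^ i) x → solves N m b (p ^ j) x
  solves-p^ p i≤j fixed = iter-fixed-∣ (rightTrans N m b) fixed (m^i∣m^j p i≤j)

numSolutions : (N : ℕ) .{{_ : NonZero N}} → ℤ → (b l : ℕ) → ℕ
numSolutions N m b l = length (filter (solves? N m b l) (upTo N))

module _ (N : ℕ) .{{_ : NonZero N}} (n b l : ℕ) .{{_ : NonZero n}} where

  solves⇔%≡% : ∀ {M} .{{_ : NonZero M}} .{{_ : NonZero (n ^ l ∸ 1)}} → N ≡ M ℕ.* (n ^ l ∸ 1) →
               ∀ {x} → x < N → solves N (+ n) b l x ⇔ (x % M ≡ b % M)
  solves⇔%≡% {M} N≡M*D {x} x<N = begin
    solves N (+ n) b l x                        ≈⟨ solves⇔∣ N (+ n) b l x<N ⟩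
    + N ∣ ((+ n) ℤ.^ l - 1ℤ) * (+ x - + b)      ≡⟨ cong₂ (λ K c → K ∣ c * (+ x - + b))
                                                     (trans (cong +_ N≡M*D) (ℤ.pos-* M D)) (sym (pos-^∸1 n l)) ⟩
    + M * + D ∣ + D * (+ x - + b)               ≈⟨ *-cancel-∣ (+ D) (+ M) (+ x - + b) ⟩
    + M ∣ + x - + b                             ≈⟨ mk⇔ mod-by _≡_mod_.divides-difference ⟩
    + x ≡ + b mod M                             ≈⟨ %≡%⇔≡-mod x b ⟨
    x % M ≡ b % M                               ∎
    where
    open SetoidReasoning (⇔-setoid 0ℓ)
    D : ℕ
    D = n ^ l ∸ 1

  numSolutions-pow : n ^ l ∸ 1 ℕ.∣ N → numSolutions N (+ n) b l ≡ n ^ l ∸ 1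
  numSolutions-pow D∣N@(ℕ.divides M N≡M*D) = begin
    length (filter (solves? N (+ n) b l) (upTo N))  ≡⟨ cong length (filter-cong-All (solves? N (+ n) b l) R?
                                                          (All.map (solves⇔%≡% {M} N≡M*D) (all-upTo N))) ⟩
    length (filter R? (upTo N))                     ≡⟨ cong (length ∘ filter R? ∘ upTo) (trans N≡M*D (ℕ.*-comm M D)) ⟩
    length (filter R? (upTo (D ℕ.* M)))             ≡⟨ length-filter-%≟-upTo M (m%n<n b M) D ⟩
    D                                               ∎
    where
    open ≡-Reasoning
    D : ℕ
    D = n ^ l ∸ 1
    instance
      _ : NonZero D
      _ = ∣-nonZero D∣N
      _ : NonZero M
      _ = ℕ.quotient≢0 D∣N
    R? : Decidable (λ x → x % M ≡ b % M)
    R? x = x % M ≟ b % M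

module _ (N : ℕ) .{{_ : NonZero N}} (m : ℤ) (p b : ℕ) where

  properSolution-zero : properSolution N m p b 0 ≐ solves N m b 1
  properSolution-zero = proj₁ , (_, [])

  properSolution-suc : ∀ i → properSolution N m p b (suc i)
                               ≐ (λ x → solves N m b (p ^ suc i) x × ¬ solves N m b (p ^ i) x)
  properSolution-suc i =
    (λ (fixed , notBefore) → fixed , All.lookup notBefore (∈-upTo⁺ (ℕ.n<1+n i))) ,
    (λ (fixed , notAt-i) → fixed , All.tabulate λ j∈ fixed-j →
                                     notAt-i (solves-p^ N m b p (ℕ.≤-pred (∈-upTo⁻ j∈)) fixed-j))

  numProperSolutions-suc : ∀ i → numProperSolutions N m p b (suc i)
                                   ≡ numSolutions N m b (p ^ suc i) ∸ numSolutions N m b (p ^ i)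
  numProperSolutions-suc i = begin
    numProperSolutions N m p b (suc i)
      ≡⟨ cong length (filter-≐ (properSolution? N m p b (suc i)) S∖S′? (properSolution-suc i) (upTo N)) ⟩
    length (filter S∖S′? (upTo N))
      ≡⟨ ℕ.m+n∸n≡m _ (#S i) ⟨
    length (filter S∖S′? (upTo N)) ℕ.+ #S i ∸ #S i
      ≡⟨ cong (_∸ #S i) (length-filter-∖ (S? (suc i)) (S? i) (solves-p^ N m b p (ℕ.n≤1+n i)) (upTo N)) ⟩
    #S (suc i) ∸ #S i
      ∎
    where
    open ≡-Reasoning
    S? : ∀ j → Decidable (solves N m b (p ^ j))
    S? j = solves? N m b (p ^ j)
    #S : ℕ → ℕ
    #S j = numSolutions N m b (p ^ j)
    S∖S′? : Decidable (λ x → solves N m b (p ^ suc i) x × ¬ solves N m b (p ^ i) x)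
    S∖S′? x = S? (suc i) x ×-dec ¬? (S? i x)

lemma2p6 : (p k n : ℕ) → Prime p → 1 ≤ k → n ≥ 2 → Coprime n p →
           .{{_ : NonZero (n ^ (p ^ k) ∸ 1)}} →
           (b : ℕ) → b < n ^ (p ^ k) ∸ 1 →
           numProperSolutions (n ^ (p ^ k) ∸ 1) (+ n) p b 0 ≡ n ∸ 1
           × ((i : ℕ) → 1 ≤ i → i ≤ k →
              numProperSolutions (n ^ (p ^ k) ∸ 1) (+ n) p b i
                ≡ n ^ (p ^ i) ∸ n ^ (p ^ (i ∸ 1)))
lemma2p6 p k n _ _ n≥2 _ b _ = properAtZero , properAtSuc
  where
  open ≡-Reasoning
  N : ℕ
  N = n ^ (p ^ k) ∸ 1
  instance
    n≢0 : NonZero n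
    n≢0 = ℕ.>-nonZero (ℕ.<-trans ℕ.z<s n≥2)
  #S : ℕ → ℕ
  #S j = numSolutions N (+ n) b (p ^ j)
  #S≡ : ∀ {j} → j ≤ k → #S j ≡ n ^ (p ^ j) ∸ 1
  #S≡ {j} j≤k = numSolutions-pow N n b (p ^ j) (n^l∸1∣n^l′∸1 n (m^i∣m^j p j≤k))
  properAtZero : numProperSolutions N (+ n) p b 0 ≡ n ∸ 1
  properAtZero = begin
    numProperSolutions N (+ n) p b 0  ≡⟨ cong length (filter-≐ _ _ (properSolution-zero N (+ n) p b) (upTo N)) ⟩
    #S 0                              ≡⟨ #S≡ z≤n ⟩
    n ^ 1 ∸ 1                         ≡⟨ cong (_∸ 1) (ℕ.*-identityʳ n) ⟩
    n ∸ 1                             ∎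
  properAtSuc : ∀ i → 1 ≤ i → i ≤ k → numProperSolutions N (+ n) p b i ≡ n ^ (p ^ i) ∸ n ^ (p ^ (i ∸ 1))
  properAtSuc (suc i) _ i<k = begin
    numProperSolutions N (+ n) p b (suc i)     ≡⟨ numProperSolutions-suc N (+ n) p b i ⟩
    #S (suc i) ∸ #S i                          ≡⟨ cong₂ _∸_ (#S≡ i<k) (#S≡ (ℕ.<⇒≤ i<k)) ⟩
    (n ^ (p ^ suc i) ∸ 1) ∸ (n ^ (p ^ i) ∸ 1)  ≡⟨ [m∸1]∸[n∸1]≡m∸n _ (ℕ.m^n>0 n (p ^ i)) ⟩
    n ^ (p ^ suc i) ∸ n ^ (p ^ i)              ∎
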